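{- Let $K$ be a field and let $\mathcal{P}$ be a polyomino such that $\operatorname{height}(I_{\mathcal{P}})=\operatorname{rank}(\mathcal{P})$. If $I_{\mathcal{P}}$ is of König type, then $|V(\mathcal{P})|\ge 2\operatorname{rank}(\mathcal{P})$.
   Context: A cell is an interval $[a,a+(1,1)]$ of $\mathbb{Z}^2$, $a\in\mathbb{Z}^2$; a polyomino $\mathcal{P}$ is a finite nonempty edge-connected set of cells, $V(\mathcal{P})$ the set of vertices of its cells and $\operatorname{rank}(\mathcal{P})$ its number of cells. A proper interval $[a,b]$ is an inner interval of $\mathcal{P}$ if all cells in it belong to $\mathcal{P}$; $x_ax_b-x_cx_d$ with $c=(a_1,b_2)$, $d=(b_1,a_2)$ is an inner 2-minor, and $I_{\mathcal{P}}\subseteq K[x_v:v\in V(\mathcal{P})]$ is generated by all inner 2-minors. A graded ideal $I$ of height $h$ in a polynomial ring $R$ is of König type if there exist homogeneous polynomials $f_1,\dots,f_h$ forming part of a minimal system of homogeneous generators of $I$ and a monomial order $<$ on $R$ such that $\mathrm{in}_<(f_1),\dots,\mathrm{in}_<(f_h)$ is a regular sequence. -}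

module Defs where

open import Level using (Level; _⊔_) renaming (suc to lsuc)
open import Algebra.Bundles using (CommutativeRing)
open import Data.Bool using (Bool; true; false; if_then_else_)
open import Data.Nat as ℕ using (ℕ; zero; suc; _≤_)
open import Data.Integer as ℤ using (ℤ)
open import Data.Product using (Σ; Σ-syntax; ∃; ∃-syntax; _×_; _,_; proj₁; proj₂; map₁)
open import Data.Product.Properties using (≡-dec)
open import Data.Sum using (_⊎_)
open import Data.Fin as Fin using (Fin; toℕ)
open import Data.Vec as Vec using (Vec)
import Data.Vec.Properties as VecP
open import Data.List as List using (List; []; _∷_; _++_; length; concatMap; deduplicate; lookup; tabulate; take; removeAt)
open import Data.List.Membership.Propositional using (_∈_)
open import Data.List.Relation.Unary.All using (All)
open import Data.List.Relation.Unary.Unique.Propositional using (Unique)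
open import Relation.Binary.PropositionalEquality using (_≡_; _≢_)
open import Relation.Nullary using (¬_; Dec; yes; no)
open import Relation.Nullary.Decidable using (⌊_⌋)
open import Function.Definitions using (Injective)

record Field (c ℓ : Level) : Set (lsuc (c ⊔ ℓ)) where
  field
    commutativeRing : CommutativeRing c ℓ
  open CommutativeRing commutativeRing public
  field
    1≉0     : ¬ (1# ≈ 0#)
    inverse : ∀ x → ¬ (x ≈ 0#) → Σ Carrier λ y → (x * y) ≈ 1#

Point : Set
Point = ℤ × ℤ

_≟P_ : (p q : Point) → Dec (p ≡ q)
_≟P_ = ≡-dec ℤ._≟_ ℤ._≟_

-- a cell [a, a+(1,1)] is represented by its lower-left corner a
Cell : Set
Cell = Point

Adjacent : Cell → Cell → Set
Adjacent (a₁ , a₂) (b₁ , b₂) =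
  ((b₁ ≡ a₁ ℤ.+ ℤ.1ℤ) × (b₂ ≡ a₂)) ⊎ ((a₁ ≡ b₁ ℤ.+ ℤ.1ℤ) × (a₂ ≡ b₂)) ⊎
  ((b₁ ≡ a₁) × (b₂ ≡ a₂ ℤ.+ ℤ.1ℤ)) ⊎ ((a₁ ≡ b₁) × (a₂ ≡ b₂ ℤ.+ ℤ.1ℤ))

data CellPath (cs : List Cell) : Cell → Cell → Set where
  here  : ∀ {c} → CellPath cs c c
  there : ∀ {c d e} → d ∈ cs → Adjacent c d → CellPath cs d e → CellPath cs c e

record Polyomino : Set where
  field
    cells     : List Cell
    distinct  : Unique cells
    nonempty  : cells ≢ []
    connected : ∀ {c d} → c ∈ cells → d ∈ cells → CellPath cells c d

open Polyomino public

rank : Polyomino → ℕ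
rank P = length (cells P)

corners : Cell → List Point
corners (a₁ , a₂) =
  (a₁ , a₂) ∷ (a₁ ℤ.+ ℤ.1ℤ , a₂) ∷ (a₁ , a₂ ℤ.+ ℤ.1ℤ) ∷ (a₁ ℤ.+ ℤ.1ℤ , a₂ ℤ.+ ℤ.1ℤ) ∷ []

VList : Polyomino → List Point
VList P = deduplicate _≟P_ (concatMap corners (cells P))

numV : Polyomino → ℕ
numV P = length (VList P)

vertex : (P : Polyomino) → Fin (numV P) → Point
vertex P i = lookup (VList P) i

InnerInterval : Polyomino → Point → Point → Set
InnerInterval P (a₁ , a₂) (b₁ , b₂) =
  (a₁ ℤ.< b₁) × (a₂ ℤ.< b₂) ×
  (∀ c₁ c₂ → a₁ ℤ.≤ c₁ → c₁ ℤ.< b₁ → a₂ ℤ.≤ c₂ → c₂ ℤ.< b₂ → (c₁ , c₂) ∈ cells P)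

-- The polynomial ring K[x_1,…,x_N] (variables indexed by Fin N).
-- Monomials are exponent vectors; polynomials are finite lists of terms,
-- compared by their coefficient functions.

module PolyRing {c ℓ} (K : Field c ℓ) (N : ℕ) where
  open Field K

  Mono : Set
  Mono = Vec ℕ N

  _≟M_ : (m m' : Mono) → Dec (m ≡ m')
  _≟M_ = VecP.≡-dec ℕ._≟_

  oneM : Mono
  oneM = Vec.replicate N 0

  _·M_ : Mono → Mono → Mono
  _·M_ = Vec.zipWith ℕ._+_

  degM : Mono → ℕ
  degM m = Vec.sum m

  varM : Fin N → Mono
  varM i = Vec.tabulate (λ j → if ⌊ i Fin.≟ j ⌋ then 1 else 0)

  Poly : Set c
  Poly = List (Carrier × Mono)

  coeff : Poly → Mono → Carrier
  coeff []             m = 0#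
  coeff ((k , m') ∷ p) m = (if ⌊ m' ≟M m ⌋ then k else 0#) + coeff p m

  _≈P_ : Poly → Poly → Set ℓ
  p ≈P q = ∀ m → coeff p m ≈ coeff q m

  0P 1P : Poly
  0P = []
  1P = (1# , oneM) ∷ []

  _+P_ : Poly → Poly → Poly
  _+P_ = _++_

  -P_ : Poly → Poly
  -P_ = List.map (map₁ (λ k → - k))

  _-P_ : Poly → Poly → Poly
  p -P q = p +P (-P q)

  _*P_ : Poly → Poly → Poly
  p *P q = concatMap (λ t → List.map (λ s → (proj₁ t * proj₁ s , proj₂ t ·M proj₂ s)) q) p

  sumP : List Poly → Poly
  sumP = List.foldr _+P_ 0P

  x : Fin N → Poly
  x i = (1# , varM i) ∷ []

  term : Carrier → Mono → Poly
  term k m = (k , m) ∷ []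

  PSet : Set (lsuc (c ⊔ ℓ))
  PSet = Poly → Set (c ⊔ ℓ)

  _⊆_ : PSet → PSet → Set (c ⊔ ℓ)
  I ⊆ J = ∀ p → I p → J p

  _⊂_ : PSet → PSet → Set (c ⊔ ℓ)
  I ⊂ J = (I ⊆ J) × Σ Poly (λ p → J p × ¬ I p)

  Gen : PSet → PSet
  Gen S p = Σ (List (Poly × Poly)) λ rs →
              All (λ t → S (proj₂ t)) rs ×
              (p ≈P sumP (List.map (λ t → proj₁ t *P proj₂ t) rs))

  ⟨_⟩ : List Poly → PSet
  ⟨ gs ⟩ = Gen (λ g → Level.Lift (c ⊔ ℓ) (g ∈ gs))

  record IsIdeal (I : PSet) : Set (c ⊔ ℓ) where
    field
      resp  : ∀ {p q} → p ≈P q → I p → I q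
      zero∈ : I 0P
      +-closed : ∀ {p q} → I p → I q → I (p +P q)
      *-closed : ∀ r {p} → I p → I (r *P p)

  record IsPrime (Q : PSet) : Set (c ⊔ ℓ) where
    field
      isIdeal : IsIdeal Q
      proper  : ¬ Q 1P
      prime   : ∀ p q → Q (p *P q) → Q p ⊎ Q q

  data ChainTo : PSet → ℕ → Set (lsuc (c ⊔ ℓ)) where
    base : ∀ {Q} → IsPrime Q → ChainTo Q 0
    step : ∀ {Q Q' k} → ChainTo Q k → IsPrime Q' → Q ⊂ Q' → ChainTo Q' (suc k)

  -- height(I) = h : the minimum over primes Q ⊇ I of height(Q) is h
  HasHeight : PSet → ℕ → Set (lsuc (c ⊔ ℓ))
  HasHeight I h =
    (Σ PSet λ Q → IsPrime Q × I ⊆ Q × ¬ ChainTo Q (suc h)) ×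
    (∀ Q → IsPrime Q → I ⊆ Q → ChainTo Q h)

  Homogeneous : Poly → Set ℓ
  Homogeneous p = Σ ℕ λ d → ∀ m → ¬ (coeff p m ≈ 0#) → degM m ≡ d

  MinimalHomGens : PSet → List Poly → Set (c ⊔ ℓ)
  MinimalHomGens I gs =
    All Homogeneous gs ×
    (I ⊆ ⟨ gs ⟩) × (⟨ gs ⟩ ⊆ I) ×
    (∀ j → ¬ (I ⊆ ⟨ removeAt gs j ⟩))

  record MonomialOrder : Set₁ where
    field
      _<_      : Mono → Mono → Set
      irrefl   : ∀ m → ¬ (m < m)
      trans    : ∀ {m m' m''} → m < m' → m' < m'' → m < m''
      total    : ∀ m m' → m < m' ⊎ m ≡ m' ⊎ m' < m
      mult     : ∀ {m m'} w → m < m' → (w ·M m) < (w ·M m')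
      one-min  : ∀ m → m ≢ oneM → oneM < m

  IsInitialMonomial : MonomialOrder → Poly → Mono → Set ℓ
  IsInitialMonomial O f m =
    ¬ (coeff f m ≈ 0#) × (∀ m' → ¬ (coeff f m' ≈ 0#) → m' ≡ m ⊎ MonomialOrder._<_ O m' m)

  initialTerm : Poly → Mono → Poly
  initialTerm f m = term (coeff f m) m

  RegularSequence : List Poly → Set (c ⊔ ℓ)
  RegularSequence gs =
    (∀ (i : Fin (length gs)) r →
       ⟨ take (toℕ i) gs ⟩ (r *P lookup gs i) → ⟨ take (toℕ i) gs ⟩ r) ×
    ¬ ⟨ gs ⟩ 1P

  KonigType : PSet → Set (lsuc (c ⊔ ℓ))
  KonigType I =
    Σ ℕ λ h → HasHeight I h ×
    Σ (List Poly) λ gs → MinimalHomGens I gs ×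
    Σ (Fin h → Fin (length gs)) λ ι → Injective _≡_ _≡_ ι ×
    Σ MonomialOrder λ O →
    Σ (Fin h → Mono) λ m →
      (∀ i → IsInitialMonomial O (lookup gs (ι i)) (m i)) ×
      RegularSequence (tabulate (λ i → initialTerm (lookup gs (ι i)) (m i)))

module _ {c ℓ} (K : Field c ℓ) (P : Polyomino) where
  open PolyRing K (numV P)

  InnerMinor : PSet
  InnerMinor f = Level.Lift (c ⊔ ℓ) (
    Σ Point λ a → Σ Point λ b → InnerInterval P a b ×
    Σ (Fin (numV P)) λ ia → Σ (Fin (numV P)) λ ib →
    Σ (Fin (numV P)) λ ic → Σ (Fin (numV P)) λ id →
      (vertex P ia ≡ a) × (vertex P ib ≡ b) ×
      (vertex P ic ≡ (proj₁ a , proj₂ b)) × (vertex P id ≡ (proj₁ b , proj₂ a)) ×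
      (f ≡ ((x ia *P x ib) -P (x ic *P x id))))

  polyominoIdeal : PSet
  polyominoIdeal = Gen InnerMinor

{-# OPTIONS --safe #-}
-- Every element of I_P is a combination of binomials x_a x_b − x_c x_d with a ≠ b and c ≠ d, so
-- every monomial in its support is divisible by two distinct variables; in particular so are the
-- initial monomials m₁,…,m_h of the König-type generators. These monomials form a regular sequence,
-- hence are pairwise coprime: if m_i and m_j (i < j) share x_b, then (m_i / x_b)·m_j ∈ (m_i), so
-- regularity puts m_i / x_b into (m₁,…,m_{j-1}); but m_i does not divide m_i / x_b, and by induction
-- on j no other m_k with k < j does either. So the m_i involve 2h distinct variables, and
-- h = height I_P = rank P.
module Submission where

open import Defs
open import Level using (lift)
open import Data.Nat as ℕ
  using (ℕ; zero; suc; _≤_; _<_; _*_; z≤n; s≤s; _≤′_; ≤′-refl; ≤′-step)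
import Data.Nat.Properties as ℕP
open import Data.Fin as Fin using (Fin; toℕ; cast; splitAt; join)
import Data.Fin.Properties as FinP
import Data.Vec as Vec
import Data.Vec.Properties as VecP
open import Data.List as List using ([]; _∷_; _++_; take; lookup; tabulate)
import Data.List.Properties as ListP
open import Data.List.Membership.Propositional using (_∈_)
open import Data.List.Membership.Propositional.Properties using (∈-lookup)
open import Data.List.Relation.Unary.Any using (here; there)
open import Data.List.Relation.Unary.All as All using (All; []; _∷_)
open import Data.Product using (Σ-syntax; ∃-syntax; _×_; _,_; proj₁; proj₂)
open import Data.Sum using (inj₁; inj₂; [_,_]′)
open import Data.Empty using (⊥)
open import Data.Bool using (true; if_then_else_)
import Data.Integer as ℤ
open import Data.Integer.Properties using (<-irrefl)
open import Function using (_∘_)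
open import Function.Definitions using (Injective)
open import Relation.Nullary using (¬_; Dec; yes; no; contradiction)
open import Relation.Nullary.Decidable using (⌊_⌋; _×-dec_; ¬?; decidable-stable; dec-true; isYes≗does)
open import Relation.Binary.Definitions using (tri<; tri≈; tri>)
open import Relation.Binary.PropositionalEquality
  using (_≡_; _≢_; refl; sym; trans; cong; subst; subst₂; module ≡-Reasoning)

∈-take-tabulate⁻ : ∀ {a} {A : Set a} {h} (f : Fin h → A) k {x} →
  x ∈ take k (tabulate f) → ∃[ i ] toℕ i < k × x ≡ f i
∈-take-tabulate⁻ {h = suc h} f (suc k) (here x≡f0) = Fin.zero , s≤s z≤n , x≡f0
∈-take-tabulate⁻ {h = suc h} f (suc k) (there x∈) with ∈-take-tabulate⁻ (f ∘ Fin.suc) k x∈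
... | i , i<k , x≡fi = Fin.suc i , s≤s i<k , x≡fi

∈-take-tabulate⁺ : ∀ {a} {A : Set a} {h} (f : Fin h → A) {k} (i : Fin h) →
  toℕ i < k → f i ∈ take k (tabulate f)
∈-take-tabulate⁺ f {suc k} Fin.zero    _         = here refl
∈-take-tabulate⁺ f {suc k} (Fin.suc i) (s≤s i<k) = there (∈-take-tabulate⁺ (f ∘ Fin.suc) i i<k)

module Polynomials {c ℓ} (K : Field c ℓ) (n : ℕ) where
  open Field K using (Carrier; _≈_; _+_; 0#; 1#; +-cong; +-congˡ; +-congʳ; +-assoc;
                      +-identityˡ; +-identityʳ; *-comm; *-identityˡ)
    renaming (_*_ to _*K_; refl to ≈-refl; sym to ≈-sym; trans to ≈-trans)
  open PolyRing K n public
  open ≡-Reasoning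

  ChainTo-pred : ∀ {Q k} → ChainTo Q (suc k) → ChainTo Q k
  ChainTo-pred {k = zero}  (step _ pQ _)        = base pQ
  ChainTo-pred {k = suc k} (step chain pQ Q⊂Q′) = step (ChainTo-pred chain) pQ Q⊂Q′

  ChainTo-≤′ : ∀ {Q a b} → a ≤′ b → ChainTo Q b → ChainTo Q a
  ChainTo-≤′ ≤′-refl        chain = chain
  ChainTo-≤′ (≤′-step a≤′b) chain = ChainTo-≤′ a≤′b (ChainTo-pred chain)

  HasHeight-≤ : ∀ {I a b} → HasHeight I a → HasHeight I b → b ≤ a
  HasHeight-≤ ((Q , prime , I⊆Q , noChain) , _) (_ , chains) =
    ℕP.≮⇒≥ λ a<b → noChain (ChainTo-≤′ (ℕP.≤⇒≤′ a<b) (chains Q prime I⊆Q))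

  HasHeight-unique : ∀ {I a b} → HasHeight I a → HasHeight I b → a ≡ b
  HasHeight-unique ha hb = ℕP.≤-antisym (HasHeight-≤ hb ha) (HasHeight-≤ ha hb)

  Occurs : Fin n → Mono → Set
  Occurs u m = 1 ≤ Vec.lookup m u

  _∣M_ : Mono → Mono → Set
  m ∣M r = ∀ u → Vec.lookup m u ≤ Vec.lookup r u

  HasTwoVariables : Mono → Set
  HasTwoVariables m = Σ[ a ∈ Fin n ] Σ[ b ∈ Fin n ] a ≢ b × Occurs a m × Occurs b m

  Coprime : Mono → Mono → Set
  Coprime m m′ = ∀ u → Occurs u m → Occurs u m′ → ⊥

  Mono-ext : ∀ {m m′ : Mono} → (∀ u → Vec.lookup m u ≡ Vec.lookup m′ u) → m ≡ m′
  Mono-ext {m} {m′} eq =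
    trans (sym (VecP.tabulate∘lookup m)) (trans (VecP.tabulate-cong eq) (VecP.tabulate∘lookup m′))

  lookup-·M : ∀ m m′ u → Vec.lookup (m ·M m′) u ≡ Vec.lookup m u ℕ.+ Vec.lookup m′ u
  lookup-·M m m′ u = VecP.lookup-zipWith ℕ._+_ u m m′

  ∣M-·M : ∀ w m → m ∣M (w ·M m)
  ∣M-·M w m u = subst (Vec.lookup m u ≤_) (sym (lookup-·M w m u)) (ℕP.m≤n+m _ _)

  HasTwoVariables-∣M : ∀ {m r} → m ∣M r → HasTwoVariables m → HasTwoVariables r
  HasTwoVariables-∣M m∣r (a , b , a≢b , a∈m , b∈m) =
    a , b , a≢b , ℕP.≤-trans a∈m (m∣r a) , ℕP.≤-trans b∈m (m∣r b)

  HasTwoVariables? : ∀ m → Dec (HasTwoVariables m)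
  HasTwoVariables? m = FinP.any? λ a → FinP.any? λ b →
    ¬? (a Fin.≟ b) ×-dec (1 ℕ.≤? Vec.lookup m a) ×-dec (1 ℕ.≤? Vec.lookup m b)

  Occurs-·Mˡ : ∀ {u m} m′ → Occurs u m → Occurs u (m ·M m′)
  Occurs-·Mˡ {u} {m} m′ u∈m =
    subst (1 ≤_) (sym (lookup-·M m m′ u)) (ℕP.≤-trans u∈m (ℕP.m≤m+n _ _))

  Occurs-·Mʳ : ∀ {u m} w → Occurs u m → Occurs u (w ·M m)
  Occurs-·Mʳ {u} {m} w u∈m = ℕP.≤-trans u∈m (∣M-·M w m u)

  Occurs-varM : ∀ u → Occurs u (varM u)
  Occurs-varM u =
    ℕP.≤-reflexive (sym (trans (VecP.lookup∘tabulate _ u) (cong (λ b → if b then 1 else 0) u≟u)))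
    where
    u≟u : ⌊ u Fin.≟ u ⌋ ≡ true
    u≟u = trans (isYes≗does (u Fin.≟ u)) (dec-true (u Fin.≟ u) refl)

  HasTwoVariables-varM·varM : ∀ {u v} → u ≢ v → HasTwoVariables (varM u ·M varM v)
  HasTwoVariables-varM·varM {u} {v} u≢v =
    u , v , u≢v , Occurs-·Mˡ {u} {varM u} (varM v) (Occurs-varM u) ,
              Occurs-·Mʳ {v} {varM v} (varM u) (Occurs-varM v)

  _/x_ : Mono → Fin n → Mono
  m /x u = Vec.updateAt m u ℕ.pred

  /x-∣M : ∀ m u → (m /x u) ∣M m
  /x-∣M m u v with v Fin.≟ u
  ... | yes refl = ℕP.≤-trans (ℕP.≤-reflexive (VecP.lookup∘updateAt u m)) ℕP.pred[n]≤n
  ... | no v≢u  = ℕP.≤-reflexive (VecP.lookup∘updateAt′ v u v≢u m)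

  ¬∣M-/x : ∀ {u m} → Occurs u m → ¬ (m ∣M (m /x u))
  ¬∣M-/x {u} {m} u∈m m∣m/u with Vec.lookup m u | m∣m/u u | VecP.lookup∘updateAt u {ℕ.pred} m
  ... | suc k | k+1≤ | refl = ℕP.1+n≰n k+1≤

  -- Both sides are m·m′/x_u.
  /x-·M-swap : ∀ {u m m′} → Occurs u m → Occurs u m′ → (m /x u) ·M m′ ≡ (m′ /x u) ·M m
  /x-·M-swap {u} {m} {m′} u∈m u∈m′ = Mono-ext λ v → begin
    Vec.lookup ((m /x u) ·M m′) v                  ≡⟨ lookup-·M (m /x u) m′ v ⟩
    Vec.lookup (m /x u) v ℕ.+ Vec.lookup m′ v      ≡⟨ pointwise v ⟩
    Vec.lookup (m′ /x u) v ℕ.+ Vec.lookup m v      ≡⟨ sym (lookup-·M (m′ /x u) m v) ⟩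
    Vec.lookup ((m′ /x u) ·M m) v                  ∎
    where
    pred-swap : ∀ {x y} → 1 ≤ x → 1 ≤ y → ℕ.pred x ℕ.+ y ≡ ℕ.pred y ℕ.+ x
    pred-swap {suc x} {suc y} _ _ =
      trans (ℕP.+-suc x y) (trans (cong suc (ℕP.+-comm x y)) (sym (ℕP.+-suc y x)))
    pointwise : ∀ v →
      Vec.lookup (m /x u) v ℕ.+ Vec.lookup m′ v ≡ Vec.lookup (m′ /x u) v ℕ.+ Vec.lookup m v
    pointwise v with v Fin.≟ u
    ... | yes refl
      rewrite VecP.lookup∘updateAt u {ℕ.pred} m | VecP.lookup∘updateAt u {ℕ.pred} m′ =
      pred-swap {Vec.lookup m u} {Vec.lookup m′ u} u∈m u∈m′
    ... | no v≢u
      rewrite VecP.lookup∘updateAt′ v u {ℕ.pred} v≢u m | VecP.lookup∘updateAt′ v u {ℕ.pred} v≢u m′ =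
      ℕP.+-comm (Vec.lookup m v) (Vec.lookup m′ v)

  coeff-++ : ∀ p q m → coeff (p ++ q) m ≈ coeff p m + coeff q m
  coeff-++ []            q m = ≈-sym (+-identityˡ _)
  coeff-++ ((k , m′) ∷ p) q m = ≈-trans (+-congˡ (coeff-++ p q m)) (≈-sym (+-assoc _ _ _))

  coeff-term-self : ∀ k m → coeff (term k m) m ≈ k
  coeff-term-self k m with m ≟M m
  ... | yes _   = +-identityʳ k
  ... | no m≢m = contradiction refl m≢m

  ·M-identityˡ : ∀ m → oneM ·M m ≡ m
  ·M-identityˡ m = Mono-ext λ u →
    trans (lookup-·M oneM m u) (cong (ℕ._+ Vec.lookup m u) (VecP.lookup-replicate u 0))

  coeff-1P*P : ∀ g m → coeff (1P *P g) m ≈ coeff g m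
  coeff-1P*P g m = ≈-trans (coeff-++ (scaled g) [] m) (≈-trans (+-identityʳ _) (go g))
    where
    scaled : Poly → Poly
    scaled = List.map λ s → (1# *K proj₁ s , oneM ·M proj₂ s)
    go : ∀ g → coeff (scaled g) m ≈ coeff g m
    go []             = ≈-refl
    go ((k , m′) ∷ g) rewrite ·M-identityˡ m′ with m′ ≟M m
    ... | yes _ = +-cong (*-identityˡ k) (go g)
    ... | no _  = +-congˡ (go g)

  ∈⇒∈⟨⟩ : ∀ {gs g} → g ∈ gs → ⟨ gs ⟩ g
  ∈⇒∈⟨⟩ {g = g} g∈gs = ((1P , g) ∷ []) , (lift g∈gs ∷ []) , λ m →
    ≈-sym (≈-trans (coeff-++ (1P *P g) [] m) (≈-trans (+-identityʳ _) (coeff-1P*P g m)))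

  NoTermDivides : Mono → Poly → Set c
  NoTermDivides r g = All (λ t → ¬ (proj₂ t ∣M r)) g

  coeff-*P-≈0 : ∀ {r g} → NoTermDivides r g → ∀ q → coeff (q *P g) r ≈ 0#
  coeff-*P-≈0 {r} {g} noDiv []      = ≈-refl
  coeff-*P-≈0 {r} {g} noDiv (t ∷ q) =
    ≈-trans (coeff-++ (shifted g) (q *P g) r)
            (≈-trans (+-cong (go noDiv) (coeff-*P-≈0 noDiv q)) (+-identityˡ 0#))
    where
    shifted : Poly → Poly
    shifted = List.map λ s → (proj₁ t *K proj₁ s , proj₂ t ·M proj₂ s)
    go : ∀ {g} → NoTermDivides r g → coeff (shifted g) r ≈ 0#
    go []                      = ≈-refl
    go {(_ , m) ∷ _} (¬m∣r ∷ noDiv) with (proj₂ t ·M m) ≟M r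
    ... | yes tm≡r = contradiction (subst (m ∣M_) tm≡r (∣M-·M (proj₂ t) m)) ¬m∣r
    ... | no _     = ≈-trans (+-identityˡ _) (go noDiv)

  coeff-Gen-≈0 : ∀ {S r p} → (∀ {g} → S g → NoTermDivides r g) → Gen S p → coeff p r ≈ 0#
  coeff-Gen-≈0 {S} {r} noDiv (rs , rs∈S , p≈) = ≈-trans (p≈ r) (go rs rs∈S)
    where
    go : ∀ rs → All (S ∘ proj₂) rs →
      coeff (sumP (List.map (λ t → proj₁ t *P proj₂ t) rs)) r ≈ 0#
    go []              []         = ≈-refl
    go ((q , g) ∷ rs) (g∈S ∷ rs∈S) =
      ≈-trans (coeff-++ (q *P g) _ r)
              (≈-trans (+-cong (coeff-*P-≈0 (noDiv g∈S) q) (go rs rs∈S)) (+-identityˡ 0#))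

  term∉⟨⟩ : ∀ {gs k r} → (∀ {g} → g ∈ gs → NoTermDivides r g) →
    ¬ k ≈ 0# → ¬ ⟨ gs ⟩ (term k r)
  term∉⟨⟩ {k = k} {r} noDiv k≉0 k·r∈ =
    k≉0 (≈-trans (≈-sym (coeff-term-self k r))
                 (coeff-Gen-≈0 {r = r} {p = term k r} (λ (lift g∈gs) → noDiv g∈gs) k·r∈))

  Gen-support : ∀ {S p m} → (∀ {g} → S g → All (HasTwoVariables ∘ proj₂) g) →
    Gen S p → ¬ coeff p m ≈ 0# → HasTwoVariables m
  Gen-support {S} {p} {m} twoVars p∈ coeff≉0 with HasTwoVariables? m
  ... | yes two = two
  ... | no ¬two = contradiction (coeff-Gen-≈0 {S} {m} {p} noDiv p∈) coeff≉0
    where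
    noDiv : ∀ {g} → S g → NoTermDivides m g
    noDiv g∈S =
      All.map (λ {t} two t∣m → ¬two (HasTwoVariables-∣M {proj₂ t} {m} t∣m two)) (twoVars g∈S)

  term-cong : ∀ {k k′ m m′} → k ≈ k′ → m ≡ m′ → term k m ≈P term k′ m′
  term-cong {m = m} k≈k′ refl r with m ≟M r
  ... | yes _ = +-congʳ k≈k′
  ... | no _  = ≈-refl

  RegularSequence-tabulate : ∀ {h} {G : Fin h → Poly} → RegularSequence (tabulate G) →
    ∀ j r → ⟨ take (toℕ j) (tabulate G) ⟩ (r *P G j) → ⟨ take (toℕ j) (tabulate G) ⟩ r
  RegularSequence-tabulate {G = G} (regular , _) j r rGj∈ =
    subst (λ k → ⟨ take k (tabulate G) ⟩ r) toℕ-j′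
      (regular j′ r
        (subst₂ (λ k g → ⟨ take k (tabulate G) ⟩ (r *P g)) (sym toℕ-j′) (sym lookup-j′) rGj∈))
    where
    j′ = cast (sym (ListP.length-tabulate G)) j
    toℕ-j′ : toℕ j′ ≡ toℕ j
    toℕ-j′ = FinP.toℕ-cast _ j
    lookup-j′ : lookup (tabulate G) j′ ≡ G j
    lookup-j′ = ListP.lookup-tabulate G j

  module _ {h} (cf : Fin h → Carrier) (mono : Fin h → Mono) where

    private
      G : Fin h → Poly
      G i = term (cf i) (mono i)

      ⟨G<_⟩ : ℕ → PSet
      ⟨G< k ⟩ = ⟨ take k (tabulate G) ⟩

    shared-variable⇒∈⟨G<⟩ : ∀ {i j u} → toℕ i < toℕ j →
      Occurs u (mono i) → Occurs u (mono j) → ⟨G< toℕ j ⟩ (term (cf i) (mono i /x u) *P G j)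
    shared-variable⇒∈⟨G<⟩ {i} {j} {u} i<j u∈i u∈j =
      ((term (cf j) (mono j /x u) , G i) ∷ []) , (lift (∈-take-tabulate⁺ G i i<j) ∷ []) ,
      term-cong (*-comm (cf i) (cf j)) (/x-·M-swap u∈i u∈j)

    CoprimeBelow : ℕ → Set
    CoprimeBelow k = ∀ i j → toℕ i < toℕ j → toℕ j < k → Coprime (mono i) (mono j)

    CoprimeBelow-≢ : ∀ {k i j} → CoprimeBelow k → toℕ i < k → toℕ j < k → i ≢ j →
      Coprime (mono i) (mono j)
    CoprimeBelow-≢ {i = i} {j} below i<k j<k i≢j with ℕP.<-cmp (toℕ i) (toℕ j)
    ... | tri< i<j _ _ = below i j i<j j<k
    ... | tri≈ _ i≡j _ = contradiction (FinP.toℕ-injective i≡j) i≢j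
    ... | tri> _ _ j<i = λ u u∈i u∈j → below j i j<i i<k u u∈j u∈i

    module _ (nonzero : ∀ i → ¬ cf i ≈ 0#) (nonconstant : ∀ i → ∃[ u ] Occurs u (mono i))
             (regular : RegularSequence (tabulate G)) where

      coprime-step : ∀ j → CoprimeBelow (toℕ j) →
        ∀ i → toℕ i < toℕ j → Coprime (mono i) (mono j)
      coprime-step j below i i<j u u∈i u∈j =
        term∉⟨⟩ {k = cf i} {mono i /x u} noDivisor (nonzero i)
          (RegularSequence-tabulate regular j (term (cf i) (mono i /x u))
            (shared-variable⇒∈⟨G<⟩ {i} {j} {u} i<j u∈i u∈j))
        where
        ¬mono∣ : ∀ k → toℕ k < toℕ j → ¬ (mono k ∣M (mono i /x u))
        ¬mono∣ k k<j k∣ with k Fin.≟ i | nonconstant k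
        ... | yes refl | _       = ¬∣M-/x {u} {mono i} u∈i k∣
        ... | no k≢i   | v , v∈k =
          CoprimeBelow-≢ below k<j i<j k≢i v v∈k
            (ℕP.≤-trans v∈k (ℕP.≤-trans (k∣ v) (/x-∣M (mono i) u v)))
        noDivisor : ∀ {g} → g ∈ take (toℕ j) (tabulate G) → NoTermDivides (mono i /x u) g
        noDivisor g∈ with ∈-take-tabulate⁻ G (toℕ j) g∈
        ... | k , k<j , refl = ¬mono∣ k k<j ∷ []

      coprimeBelow : ∀ k → CoprimeBelow k
      coprimeBelow (suc k) i j i<j j<1+k = coprime-step j below i i<j
        where
        below : CoprimeBelow (toℕ j)
        below i′ j′ i′<j′ j′<j = coprimeBelow k i′ j′ i′<j′ (ℕP.<-≤-trans j′<j (ℕP.≤-pred j<1+k))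

      RegularSequence-terms⇒Coprime : ∀ i j → i ≢ j → Coprime (mono i) (mono j)
      RegularSequence-terms⇒Coprime i j =
        CoprimeBelow-≢ (coprimeBelow h) (FinP.toℕ<n i) (FinP.toℕ<n j)

  pairwise-coprime⇒2*≤ : ∀ {h} (mono : Fin h → Mono) →
    (∀ i j → i ≢ j → Coprime (mono i) (mono j)) → (∀ i → HasTwoVariables (mono i)) → 2 * h ≤ n
  pairwise-coprime⇒2*≤ {h} mono coprime twoVars =
    subst (_≤ n) (cong (h ℕ.+_) (sym (ℕP.+-identityʳ h))) (FinP.injective⇒≤ variable-injective)
    where
    a b : Fin h → Fin n
    a i = proj₁ (twoVars i)
    b i = proj₁ (proj₂ (twoVars i))
    a≢b : ∀ i → a i ≢ b i
    a≢b i with twoVars i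
    ... | _ , _ , a≢b , _ = a≢b
    a∈ : ∀ i → Occurs (a i) (mono i)
    a∈ i with twoVars i
    ... | _ , _ , _ , a∈ , _ = a∈
    b∈ : ∀ i → Occurs (b i) (mono i)
    b∈ i with twoVars i
    ... | _ , _ , _ , _ , b∈ = b∈

    shared⇒≡ : ∀ {i j u v} → u ≡ v → Occurs u (mono i) → Occurs v (mono j) → i ≡ j
    shared⇒≡ {i} {j} {u} refl u∈i u∈j =
      decidable-stable (i Fin.≟ j) λ i≢j → coprime i j i≢j u u∈i u∈j

    a-or-b-injective : Injective _≡_ _≡_ [ a , b ]′
    a-or-b-injective {inj₁ i} {inj₁ j} ai≡aj = cong inj₁ (shared⇒≡ {i} {j} ai≡aj (a∈ i) (a∈ j))
    a-or-b-injective {inj₁ i} {inj₂ j} ai≡bj with refl ← shared⇒≡ {i} {j} ai≡bj (a∈ i) (b∈ j) =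
      contradiction ai≡bj (a≢b i)
    a-or-b-injective {inj₂ i} {inj₁ j} bi≡aj with refl ← shared⇒≡ {i} {j} bi≡aj (b∈ i) (a∈ j) =
      contradiction (sym bi≡aj) (a≢b i)
    a-or-b-injective {inj₂ i} {inj₂ j} bi≡bj = cong inj₂ (shared⇒≡ {i} {j} bi≡bj (b∈ i) (b∈ j))

    variable-injective : Injective _≡_ _≡_ ([ a , b ]′ ∘ splitAt h)
    variable-injective {x} {y} eq = begin
      x                         ≡⟨ FinP.join-splitAt h h x ⟨
      join h h (splitAt h x)    ≡⟨ cong (join h h) (a-or-b-injective {splitAt h x} {splitAt h y} eq) ⟩
      join h h (splitAt h y)    ≡⟨ FinP.join-splitAt h h y ⟩
      y                         ∎

module _ {c ℓ} (K : Field c ℓ) (P : Polyomino) where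
  open Field K using (_≈_; 0#)
  open Polynomials K (numV P)

  ≢-by-x-coordinate : ∀ {u v p q} →
    vertex P u ≡ p → vertex P v ≡ q → proj₁ p ℤ.< proj₁ q → u ≢ v
  ≢-by-x-coordinate refl refl p<q refl = <-irrefl refl p<q

  InnerMinor-HasTwoVariables : ∀ {f} → InnerMinor K P f → All (HasTwoVariables ∘ proj₂) f
  InnerMinor-HasTwoVariables (lift (_ , _ , (a₁<b₁ , _) , _ , _ , _ , _ , va , vb , vc , vd , refl)) =
    HasTwoVariables-varM·varM (≢-by-x-coordinate va vb a₁<b₁) ∷
    HasTwoVariables-varM·varM (≢-by-x-coordinate vc vd a₁<b₁) ∷ []

  polyominoIdeal-support : ∀ {p m} → polyominoIdeal K P p → ¬ coeff p m ≈ 0# → HasTwoVariables m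
  polyominoIdeal-support {p} {m} = Gen-support {p = p} {m} InnerMinor-HasTwoVariables

lemma2p3 : ∀ {c ℓ} (K : Field c ℓ) (P : Polyomino) →
    PolyRing.HasHeight K (numV P) (polyominoIdeal K P) (rank P) →
    PolyRing.KonigType K (numV P) (polyominoIdeal K P) →
    2 * rank P ≤ numV P
lemma2p3 K P height (h , height′ , gs , (_ , _ , ⟨gs⟩⊆I , _) , ι , _ , _ , m , initial , regular) =
  subst (λ k → 2 * k ≤ numV P) (HasHeight-unique height′ height)
    (pairwise-coprime⇒2*≤ m coprime twoVariables)
  where
  open Polynomials K (numV P)
  g : Fin h → Poly
  g i = lookup gs (ι i)
  twoVariables : ∀ i → HasTwoVariables (m i)
  twoVariables i = polyominoIdeal-support K P {g i} {m i}
    (⟨gs⟩⊆I (g i) (∈⇒∈⟨⟩ (∈-lookup (ι i)))) (proj₁ (initial i))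
  nonconstant : ∀ i → ∃[ u ] Occurs u (m i)
  nonconstant i with twoVariables i
  ... | u , _ , _ , u∈ , _ = u , u∈
  coprime : ∀ i j → i ≢ j → Coprime (m i) (m j)
  coprime = RegularSequence-terms⇒Coprime (λ i → coeff (g i) (m i)) m
    (proj₁ ∘ initial) nonconstant regular
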